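{- Let $(\mathbf S,\mathcal A,\to)$ be a PTS. For every process $s\in\mathbf S$ and every $k\in\mathbb N$, $s\models\varphi_s^k$. Moreover, if $s$ is finite, then $s\models\varphi_s$.
   Context: A PTS is a triple $(\mathbf S,\mathcal A,\to)$ with $\mathbf S$ a countable set of processes, $\mathcal A$ a countable set of actions and $\to\subseteq\mathbf S\times\mathcal A\times\Delta(\mathbf S)$, where $\Delta(\mathbf S)$ is the set of probability distributions on $\mathbf S$ with finite support. Write $s\xrightarrow{a}\pi$ for $(s,a,\pi)\in\to$; $\mathrm{init}(s)=\{a\mid \exists\pi.\ s\xrightarrow a\pi\}$; $\mathrm{der}(s,a)=\{\pi\mid s\xrightarrow a\pi\}$; $\mathrm{supp}(\pi)=\{t\mid\pi(t)>0\}$. The depth of $s$ is $0$ if $\mathrm{init}(s)=\emptyset$ and otherwise $1+\sup\{\mathrm{depth}(t)\mid a\in\mathrm{init}(s),\pi\in\mathrm{der}(s,a),t\in\mathrm{supp}(\pi)\}$. A process is finite if $\mathrm{der}(s,a)$ is finite for every $a$ (image-finite) and its depth is finite. Logic $\mathcal L$: state formulae $\varphi::=\top\mid\neg\varphi\mid\bigwedge_{j\in J}\varphi_j\mid\langle a\rangle\psi$ ($J\neq\emptyset$ at most countable, $a\in\mathcal A$); distribution formulae $\psi::=\bigoplus_{i\in I}r_i\varphi_i$ ($I$ finite nonempty, $r_i\in(0,1]$, $\sum_i r_i=1$). Write $\langle a\rangle\varphi$ for $\langle a\rangle(1\varphi)$. Satisfaction: $s\models\top$ always; $s\models\neg\varphi$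 iff not $s\models\varphi$; $s\models\bigwedge_j\varphi_j$ iff $s\models\varphi_j$ for all $j$; $s\models\langle a\rangle\psi$ iff $s\xrightarrow a\pi$ for some $\pi$ with $\pi\models\psi$; $\pi\models\bigoplus_{i\in I}r_i\varphi_i$ iff $\pi=\sum_{i\in I}r_i\pi_i$ for some $\pi_i\in\Delta(\mathbf S)$ such that $t\models\varphi_i$ for all $i$ and all $t\in\mathrm{supp}(\pi_i)$. Mimicking formulae: $\varphi_s^0=\top$ and, for $k\ge1$, $\varphi_s^k=\bigwedge_{(s,a,\pi)\in\to}\langle a\rangle\psi_\pi^{k-1}\wedge\bigwedge_{b\notin\mathrm{init}(s)}\neg\langle b\rangle\top$ (a single conjunction over all these conjuncts), where $\psi_\pi^k=\bigoplus_{t\in\mathrm{supp}(\pi)}\pi(t)\varphi_t^k$. For finite $s$, the mimicking formula is $\varphi_s=\varphi_s^{\mathrm{depth}(s)+1}$. -}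

module Defs where

open import Level using (0ℓ)
open import Data.Nat using (ℕ; zero; suc; _≤_)
open import Data.Fin using (Fin; zero; suc)
open import Data.List using (List; length; lookup)
open import Data.List.Membership.Propositional using (_∈_; _∉_)
open import Data.List.Relation.Unary.Unique.Propositional using (Unique)
open import Data.Product using (Σ; ∃; _×_; _,_)
open import Data.Sum using (_⊎_; inj₁; inj₂)
open import Data.Unit using (⊤)
open import Relation.Nullary using (¬_)
open import Relation.Binary.PropositionalEquality using (_≡_)
open import Relation.Binary.Structures using (IsTotalOrder)
open import Algebra.Bundles using (CommutativeRing)

record RealField : Set₁ where
  field
    commRing : CommutativeRing 0ℓ 0ℓ
  open CommutativeRing commRing public using (Carrier; _≈_; _+_; _*_; 0#; 1#)
  field
    _≤ᵣ_        : Carrier → Carrier → Set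
    isTotalOrder : IsTotalOrder _≈_ _≤ᵣ_
    +-mono-≤    : ∀ {x y} z → x ≤ᵣ y → (x + z) ≤ᵣ (y + z)
    *-nonneg    : ∀ {x y} → 0# ≤ᵣ x → 0# ≤ᵣ y → 0# ≤ᵣ (x * y)
    0≉1         : ¬ (0# ≈ 1#)
    inverse     : ∀ x → ¬ (x ≈ 0#) → ∃ λ y → (x * y) ≈ 1#
    sup         : (P : Carrier → Set) → ∃ P → (∃ λ b → ∀ x → P x → x ≤ᵣ b) →
                  ∃ λ u → (∀ x → P x → x ≤ᵣ u) ×
                          (∀ b → (∀ x → P x → x ≤ᵣ b) → u ≤ᵣ b)

  _<ᵣ_ : Carrier → Carrier → Set
  x <ᵣ y = (x ≤ᵣ y) × ¬ (x ≈ y)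

  sumL : List Carrier → Carrier
  sumL Data.List.[] = 0#
  sumL (x Data.List.∷ xs) = x + sumL xs

  sumF : ∀ {n} → (Fin n → Carrier) → Carrier
  sumF {zero}  f = 0#
  sumF {suc n} f = f zero + sumF (λ i → f (suc i))

module Prob (ℝ : RealField) where
  open RealField ℝ

  record Dist (S : Set) : Set where
    field
      mass     : S → Carrier
      nonneg   : ∀ t → 0# ≤ᵣ mass t
      support  : List S
      unique   : Unique support
      supp-pos : ∀ t → t ∈ support → 0# <ᵣ mass t
      supp-out : ∀ t → t ∉ support → mass t ≈ 0#
      total    : sumL (Data.List.map mass support) ≈ 1#
  open Dist public

  record PTS : Set₁ where
    field
      S           : Set
      A           : Set
      S-countable : Σ (S → ℕ) λ f → ∀ {x y} → f x ≡ f y → x ≡ y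
      A-countable : Σ (A → ℕ) λ f → ∀ {x y} → f x ≡ f y → x ≡ y
      _⟶⟨_⟩_      : S → A → Dist S → Set

module Theory (ℝ : RealField) (P : Prob.PTS ℝ) where
  open RealField ℝ
  open Prob ℝ
  open PTS P

  mutual
    data StateF : Set₁ where
      ⊤ᶠ  : StateF
      ¬ᶠ  : StateF → StateF
      ⋀   : {J : Set} → (J → StateF) → StateF
      ⟨_⟩_ : A → DistF → StateF

    data DistF : Set₁ where
      ⊕ : (n : ℕ) → (r : Fin n → Carrier) → (φ : Fin n → StateF) → DistF

  ⟨_⟩₁_ : A → StateF → StateF
  ⟨ a ⟩₁ φ = ⟨ a ⟩ ⊕ 1 (λ _ → 1#) (λ _ → φ)

  mutual
    _⊨_ : S → StateF → Set
    s ⊨ ⊤ᶠ = ⊤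
    s ⊨ ¬ᶠ φ = ¬ (s ⊨ φ)
    s ⊨ ⋀ f = ∀ j → s ⊨ f j
    s ⊨ (⟨ a ⟩ ψ) = ∃ λ π → (s ⟶⟨ a ⟩ π) × (π ⊨ᴰ ψ)

    _⊨ᴰ_ : Dist S → DistF → Set
    π ⊨ᴰ ⊕ n r φ =
      ∃ λ (πs : Fin n → Dist S) →
        (∀ u → mass π u ≈ sumF (λ i → r i * mass (πs i) u)) ×
        (∀ i t → t ∈ support (πs i) → t ⊨ φ i)

  init : S → A → Set
  init s a = ∃ λ π → s ⟶⟨ a ⟩ π

  mutual
    φ : S → ℕ → StateF
    φ s zero = ⊤ᶠ
    φ s (suc k) = ⋀ {J = (Σ A λ a → Σ (Dist S) λ π → s ⟶⟨ a ⟩ π)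
                         ⊎ (Σ A λ b → ¬ init s b)} conj
      where
        conj : _ → StateF
        conj (inj₁ (a , π , _)) = ⟨ a ⟩ ψ π k
        conj (inj₂ (b , _))     = ¬ᶠ (⟨ b ⟩₁ ⊤ᶠ)

    ψ : Dist S → ℕ → DistF
    ψ π k = ⊕ (length (support π))
              (λ i → mass π (lookup (support π) i))
              (λ i → φ (lookup (support π) i) k)

  DepthLE : S → ℕ → Set
  DepthLE s zero    = ∀ a π → ¬ (s ⟶⟨ a ⟩ π)
  DepthLE s (suc n) = ∀ a π → s ⟶⟨ a ⟩ π → ∀ t → t ∈ support π → DepthLE t n

  Depth : S → ℕ → Set
  Depth s d = DepthLE s d × (∀ m → DepthLE s m → d ≤ m)

  ImageFinite : S → Set
  ImageFinite s = ∀ a → ∃ λ (L : List (Dist S)) → ∀ π → s ⟶⟨ a ⟩ π → π ∈ L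

  Finite : S → Set
  Finite s = ImageFinite s × ∃ λ d → DepthLE s d

  -- the mimicking formula φ_s = φ_s^{depth(s)+1}, for s of depth d
  φ-mim : S → ℕ → StateF
  φ-mim s d = φ s (suc d)

module Submission where

-- Every support point t of π satisfies φ_t^k (by induction on k), so writing
-- π = Σ_{t ∈ supp π} π(t)·δ_t, with δ_t the Dirac distribution at t, witnesses
-- π ⊨ ψ_π^k. Hence each conjunct ⟨a⟩ψ_π^k of φ_s^{k+1} holds via the transition
-- s →a π itself, and each ¬⟨b⟩⊤ holds because b ∉ init(s). The mimicking
-- formula is the instance k = depth(s) + 1.

open import Defs
open import Data.Nat using (ℕ; zero; suc)
import Data.Nat.Properties as ℕ
open import Data.Product using (_×_; _,_; proj₁; proj₂)
open import Data.Sum using (inj₁; inj₂)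
open import Data.List using (List; []; _∷_; length; lookup)
open import Data.List.Relation.Unary.Any using (here; there)
open import Data.List.Relation.Unary.All as All using ()
open import Data.List.Relation.Unary.AllPairs using ([]; _∷_)
open import Data.List.Relation.Unary.Unique.Propositional using (Unique)
open import Data.List.Membership.Propositional using (_∈_; _∉_)
open import Data.List.Membership.Propositional.Properties using (∈-lookup)
open import Data.Empty using (⊥-elim)
open import Function.Bundles using (mk↣)
open import Relation.Nullary using (Dec; yes; no)
open import Relation.Binary.Definitions using (DecidableEquality)
import Relation.Binary.PropositionalEquality as ≡
open import Relation.Binary.Structures using (IsTotalOrder; IsPartialOrder)
open import Algebra.Bundles using (CommutativeRing)
import Algebra.Properties.Ring as RingProperties

module OrderedField (ℝ : RealField) where
  open RealField ℝ
  open CommutativeRing commRing using (-_; -‿cong; -‿inverseʳ; +-identityˡ; *-identityˡ; sym; trans)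
  open RingProperties (CommutativeRing.ring commRing) using (-‿distribˡ-*; -‿involutive)
  open IsTotalOrder isTotalOrder using (total; isPartialOrder)
  open IsPartialOrder isPartialOrder using (antisym; ≤-resp-≈)

  -1*-1≈1 : (- 1#) * (- 1#) ≈ 1#
  -1*-1≈1 = trans (sym (-‿distribˡ-* 1# (- 1#))) (trans (-‿cong (*-identityˡ (- 1#))) (-‿involutive 1#))

  0≤1 : 0# ≤ᵣ 1#
  0≤1 with total 0# 1#
  ... | inj₁ 0≤1 = 0≤1
  ... | inj₂ 1≤0 = ⊥-elim (0≉1 (antisym (proj₁ ≤-resp-≈ -1*-1≈1 (*-nonneg 0≤-1 0≤-1)) 1≤0))
    where
      0≤-1 : 0# ≤ᵣ (- 1#)
      0≤-1 = proj₂ ≤-resp-≈ (-‿inverseʳ 1#) (proj₁ ≤-resp-≈ (+-identityˡ (- 1#)) (+-mono-≤ (- 1#) 1≤0))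

module DiracDecomposition (ℝ : RealField) {S : Set} (_≟_ : DecidableEquality S) where
  open RealField ℝ
  open Prob ℝ
  open OrderedField ℝ using (0≤1)
  open CommutativeRing commRing using (refl; sym; trans; +-cong; +-identityˡ; +-identityʳ; *-identityʳ; zeroʳ)
  open IsTotalOrder isTotalOrder using (isPartialOrder)
  open IsPartialOrder isPartialOrder using (reflexive)
  open import Data.List.Membership.DecPropositional _≟_ using (_∈?_)

  indicator : ∀ {X : Set} → Dec X → Carrier
  indicator (yes _) = 1#
  indicator (no _)  = 0#

  δ : S → Dist S
  δ t = record
    { mass     = λ u → indicator (u ≟ t)
    ; nonneg   = nonneg-δ
    ; support  = t ∷ []
    ; unique   = All.[] ∷ []
    ; supp-pos = supp-pos-δ
    ; supp-out = supp-out-δ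
    ; total    = total-δ
    }
    where
      nonneg-δ : ∀ u → 0# ≤ᵣ indicator (u ≟ t)
      nonneg-δ u with u ≟ t
      ... | yes _ = 0≤1
      ... | no _  = reflexive refl

      supp-pos-δ : ∀ u → u ∈ t ∷ [] → 0# <ᵣ indicator (u ≟ t)
      supp-pos-δ u (here u≡t) with u ≟ t
      ... | yes _  = 0≤1 , 0≉1
      ... | no u≢t = ⊥-elim (u≢t u≡t)

      supp-out-δ : ∀ u → u ∉ t ∷ [] → indicator (u ≟ t) ≈ 0#
      supp-out-δ u u∉ with u ≟ t
      ... | yes u≡t = ⊥-elim (u∉ (here u≡t))
      ... | no _    = refl

      total-δ : indicator (t ≟ t) + 0# ≈ 1#
      total-δ with t ≟ t
      ... | yes _  = +-identityʳ 1#
      ... | no t≢t = ⊥-elim (t≢t ≡.refl)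

  mixture : (S → Carrier) → (L : List S) → S → Carrier
  mixture m L u = sumF {length L} (λ i → m (lookup L i) * mass (δ (lookup L i)) u)

  mixture-∉ : ∀ m L {u} → u ∉ L → mixture m L u ≈ 0#
  mixture-∉ m []      u∉ = refl
  mixture-∉ m (x ∷ L) {u} u∉ with u ≟ x
  ... | yes u≡x = ⊥-elim (u∉ (here u≡x))
  ... | no _    = trans (+-cong (zeroʳ (m x)) (mixture-∉ m L (λ u∈ → u∉ (there u∈)))) (+-identityˡ 0#)

  mixture-∈ : ∀ m L {u} → Unique L → u ∈ L → mixture m L u ≈ m u
  mixture-∈ m (x ∷ L) {u} (x∉L ∷ uniq) u∈ with u ≟ x | u∈
  ... | yes ≡.refl | _ =
    trans (+-cong (*-identityʳ (m x)) (mixture-∉ m L (λ u∈L → All.lookup x∉L u∈L ≡.refl))) (+-identityʳ (m x))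
  ... | no u≢x | here u≡x = ⊥-elim (u≢x u≡x)
  ... | no _   | there u∈L = trans (+-cong (zeroʳ (m x)) (mixture-∈ m L uniq u∈L)) (+-identityˡ (m u))

  mass≈mixture-of-support : ∀ π u → mass π u ≈ mixture (mass π) (support π) u
  mass≈mixture-of-support π u with u ∈? support π
  ... | yes u∈ = sym (mixture-∈ (mass π) (support π) (unique π) u∈)
  ... | no u∉  = trans (supp-out π u u∉) (sym (mixture-∉ (mass π) (support π) u∉))

module Mimicking (ℝ : RealField) (P : Prob.PTS ℝ) where
  open RealField ℝ
  open Prob ℝ
  open PTS P
  open Theory ℝ P
  open DiracDecomposition ℝ (ℕ.eq? (mk↣ (proj₂ S-countable)))

  ⊨ᴰ-support-mixture : ∀ π (f : S → StateF) → (∀ t → t ∈ support π → t ⊨ f t) →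
    π ⊨ᴰ ⊕ (length (support π)) (λ i → mass π (lookup (support π) i)) (λ i → f (lookup (support π) i))
  ⊨ᴰ-support-mixture π f sat =
    (λ i → δ (lookup (support π) i)) , mass≈mixture-of-support π , at-atom
    where
      at-atom : ∀ i t → t ∈ support (δ (lookup (support π) i)) → t ⊨ f (lookup (support π) i)
      at-atom i t (here ≡.refl) = sat t (∈-lookup i)

  ⊨φ : ∀ s k → s ⊨ φ s k
  ⊨φ s zero = _
  ⊨φ s (suc k) (inj₁ (a , π , s→π)) = π , s→π , ⊨ᴰ-support-mixture π (λ t → φ t k) (λ t _ → ⊨φ t k)
  ⊨φ s (suc k) (inj₂ (b , b∉init)) (π , s→π , _) = b∉init (π , s→π)

theorem1 : (ℝ : RealField) (P : Prob.PTS ℝ) →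
    let open Prob.PTS P using (S)
        open Theory ℝ P
    in ((s : S) (k : ℕ) → s ⊨ φ s k) ×
       ((s : S) → Finite s → (d : ℕ) → Depth s d → s ⊨ φ-mim s d)
theorem1 ℝ P = ⊨φ , λ s _ d _ → ⊨φ s (suc d)
  where open Mimicking ℝ P
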